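{- If $G$ is the Hamming graph $\prod_{i=1}^t K_{n_i}$ with $t\ge1$ and $n_1,\dots,n_t\ge2$, then $\text{min-seed}(G,2)=1+\lceil t/2\rceil$.
   Context: The Hamming graph $\prod_{i=1}^t K_{n_i}=K_{n_1}\Box\cdots\Box K_{n_t}$ has vertex set $V(K_{n_1})\times\cdots\times V(K_{n_t})$, two vertices being adjacent iff they differ in exactly one coordinate. For $S\subseteq V(G)$, $[S]^G_2$ is the set of vertices active at the end of the process: initially exactly the vertices of $S$ are active; at each step every inactive vertex with at least $2$ active neighbours becomes active; stop when nothing changes. $\text{min-seed}(G,2)=\min\{|S|:S\subseteq V(G),\ [S]^G_2=V(G)\}$. -}

module Defs where

open import Data.Nat using (ℕ; zero; suc; _≤_)
open import Data.Fin using (Fin)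
open import Data.List using (List; length)
open import Data.List.Relation.Unary.Any using (Any)
open import Data.List.Relation.Unary.AllPairs using (AllPairs)
open import Data.Product using (Σ; ∃; _×_; _,_)
open import Data.Sum using (_⊎_)
open import Relation.Binary.PropositionalEquality using (_≡_; _≢_)
open import Relation.Nullary using (¬_)

Vertex : (t : ℕ) → (Fin t → ℕ) → Set
Vertex t n = (i : Fin t) → Fin (n i)

module _ {t : ℕ} {n : Fin t → ℕ} where

  SameVertex : Vertex t n → Vertex t n → Set
  SameVertex u v = ∀ i → u i ≡ v i

  Distinct : Vertex t n → Vertex t n → Set
  Distinct u v = ¬ SameVertex u v

  Adjacent : Vertex t n → Vertex t n → Set
  Adjacent u v = Σ (Fin t) λ i → (u i ≢ v i) × (∀ j → j ≢ i → u j ≡ v j)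

  _∈S_ : Vertex t n → List (Vertex t n) → Set
  v ∈S S = Any (SameVertex v) S

  IsSet : List (Vertex t n) → Set
  IsSet S = AllPairs Distinct S

  -- Active S k v : v is active after k rounds of 2-neighbour bootstrap
  -- percolation started from S
  Active : List (Vertex t n) → ℕ → Vertex t n → Set
  Active S zero v = v ∈S S
  Active S (suc k) v =
    Active S k v ⊎
    Σ (Vertex t n) λ u → Σ (Vertex t n) λ w →
      Distinct u w × Adjacent u v × Adjacent w v × Active S k u × Active S k w

  Percolates : List (Vertex t n) → Set
  Percolates S = Σ ℕ λ k → ∀ v → Active S k v

  MinSeed2≡ : ℕ → Set
  MinSeed2≡ m =
    (Σ (List (Vertex t n)) λ S → IsSet S × length S ≡ m × Percolates S) ×
    (∀ (S : List (Vertex t n)) → IsSet S → Percolates S → m ≤ length S)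

module Submission where

open import Defs
open import Data.Nat using (ℕ; _≤_; _+_; ⌈_/2⌉)
open import Data.Fin using (Fin)

-- min-seed(K_{n_1} □ ⋯ □ K_{n_t}, 2) = 1 + ⌈t/2⌉ whenever every n_i ≥ 2.
--
-- A box is a subcube: a set of free coordinates and a base
-- vertex fixing the others; it costs 2 + (number of free coordinates).  Two boxes
-- are near when their fixed coordinates conflict in at most two places, and near
-- boxes merge into one box costing at most their sum.  Inserting the seeds one at
-- a time and merging greedily gives a cover of S by pairwise non-near boxes of
-- total cost ≤ 2|S|; such a cover is closed under the 2-neighbour rule, so it
-- covers every active vertex.  If S percolates, the box of a vertex z contains all
-- neighbours of z, hence all t coordinates are free and 2 + t ≤ 2|S|.
--
-- The key step 'grow': if a subcube
-- through b is active and so is a vertex differing from b in exactly one further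
-- coordinate j, then the subcube enlarged by j becomes active.  Split the
-- coordinates into the ⌈t/2⌉ blocks {0,1}, {2,3}, … ('pairing') and take a vertex
-- z together with, for every block, the vertex differing from z exactly on that
-- block.  Starting from the subcube {z}, every block seed lets the active subcube
-- absorb its block, until all vertices are active.

open import Data.Nat using (zero; suc; _<_; _⊔_; s≤s; z≤n; _≤′_; ≤′-reflexive; ≤′-step; _≤?_; ⌊_/2⌋)
open import Data.Nat.Properties
  using (module ≤-Reasoning; ≤-refl; ≤-trans; ≤-reflexive; ≤⇒≤′; ≤-pred; m≤m+n; m≤n+m; m≤m⊔n; m≤n⊔m; +-mono-≤; +-monoʳ-≤; +-suc; +-assoc; +-comm; ⌈n/2⌉-mono; +-commutativeSemigroup)
open import Algebra.Properties.CommutativeSemigroup +-commutativeSemigroup using (x∙yz≈y∙xz)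
open import Data.Nat.ListAction using (sum)
open import Data.Fin as Fin using (_≟_)
open import Data.Fin.Properties using (all?) renaming (suc-injective to fin-suc-injective)
open import Data.Fin.Subset using (Subset; inside; outside; _∈_; _∉_; ⊥; ⊤; _∪_; ⁅_⁆; ∣_∣)
open import Data.Fin.Subset.Properties
  using (_∈?_; anySubset?; ∣p∣≤∣x∷p∣; ∣⊥∣≡0; ∣⊤∣≡n; ∣⁅x⁆∣≡1; x∈⁅x⁆; p⊆q⇒∣p∣≤∣q∣; p⊆p∪q; q⊆p∪q)
open import Data.List using (List; []; _∷_; length; map; allFin)
open import Data.Vec using ([]; _∷_)
open import Data.List.Properties using (length-removeAt′; length-map)
open import Data.List.Membership.Propositional using () renaming (_∈_ to _∈ˡ_)
open import Data.List.Membership.Propositional.Properties using (∈-allFin)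
open import Data.List.Relation.Unary.Any as Any using (Any; here; there; _─_)
open import Data.List.Relation.Unary.Any.Properties using (lookup-result) renaming (map⁺ to Any-map⁺)
open import Data.List.Relation.Unary.All as All using (All; []; _∷_)
open import Data.List.Relation.Unary.All.Properties using (─⁺) renaming (map⁺ to All-map⁺)
open import Data.List.Relation.Unary.All.Properties.Core using (¬Any⇒All¬)
open import Data.List.Relation.Unary.AllPairs as AllPairs using (AllPairs; []; _∷_)
open import Data.List.Relation.Unary.AllPairs.Properties using () renaming (map⁺ to AllPairs-map⁺)
open import Data.Product using (Σ; ∃; _×_; _,_; proj₁; proj₂)
open import Data.Sum using (_⊎_; inj₁; inj₂; [_,_]; assocˡ; swap) renaming (map₂ to ⊎-map₂; map to ⊎-map)
open import Data.Empty using (⊥-elim) renaming (⊥ to Empty)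
open import Function using (_∘_; id)
open import Relation.Nullary using (¬_; Dec; yes; no)
open import Relation.Nullary.Decidable using (¬?; _×-dec_; _⊎-dec_; _→-dec_)
open import Relation.Binary.PropositionalEquality using (_≡_; _≢_; refl; sym; trans; cong; cong₂)

module Removal {A : Set} {P : A → Set} where

  ∈-─ : ∀ {x xs} (p : Any P xs) → x ∈ˡ xs → x ≡ Any.lookup p ⊎ x ∈ˡ (xs ─ p)
  ∈-─ (here _)  (here refl) = inj₁ refl
  ∈-─ (here _)  (there x∈)  = inj₂ x∈
  ∈-─ (there _) (here refl) = inj₂ (here refl)
  ∈-─ (there p) (there x∈)  = ⊎-map₂ there (∈-─ p x∈)

  AllPairs-─ : ∀ {R : A → A → Set} {xs} (p : Any P xs) → AllPairs R xs → AllPairs R (xs ─ p)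
  AllPairs-─ (here _)  (_ ∷ rs)  = rs
  AllPairs-─ (there p) (r ∷ rs) = ─⁺ p r ∷ AllPairs-─ p rs

  sum-─ : ∀ (f : A → ℕ) {xs} (p : Any P xs) → sum (map f xs) ≡ f (Any.lookup p) + sum (map f (xs ─ p))
  sum-─ f (here _) = refl
  sum-─ f {x ∷ _} (there p) = trans (cong (f x +_) (sum-─ f p)) (x∙yz≈y∙xz (f x) (f (Any.lookup p)) _)

open Removal

∣p∪q∣≤∣p∣+∣q∣ : ∀ {m} (p q : Subset m) → ∣ p ∪ q ∣ ≤ ∣ p ∣ + ∣ q ∣
∣p∪q∣≤∣p∣+∣q∣ []            []            = z≤n
∣p∪q∣≤∣p∣+∣q∣ (outside ∷ p) (outside ∷ q) = ∣p∪q∣≤∣p∣+∣q∣ p q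
∣p∪q∣≤∣p∣+∣q∣ (outside ∷ p) (inside  ∷ q) = ≤-trans (s≤s (∣p∪q∣≤∣p∣+∣q∣ p q)) (≤-reflexive (sym (+-suc ∣ p ∣ ∣ q ∣)))
∣p∪q∣≤∣p∣+∣q∣ (inside  ∷ p) (s       ∷ q) = s≤s (≤-trans (∣p∪q∣≤∣p∣+∣q∣ p q) (+-monoʳ-≤ ∣ p ∣ (∣p∣≤∣x∷p∣ s q)))

module Hamming (t : ℕ) (n : Fin t → ℕ) where

  V : Set
  V = Vertex t n

  AgreeOutside : (Fin t → Set) → V → V → Set
  AgreeOutside F x y = ∀ i → ¬ F i → x i ≡ y i

  _⊕_ : (Fin t → Set) → Fin t → Fin t → Set
  (F ⊕ j) i = F i ⊎ i ≡ j

  agree-widen : ∀ {F G : Fin t → Set} {x y : V} → (∀ i → F i → G i) → AgreeOutside F x y → AgreeOutside G x y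
  agree-widen F⊆G agree i i∉G = agree i (i∉G ∘ F⊆G i)

  agree-fill : ∀ {F : Fin t → Set} {x y : V} {j} → AgreeOutside (F ⊕ j) x y → x j ≡ y j → AgreeOutside F x y
  agree-fill {j = j} agree xj≡yj i i∉F with i ≟ j
  ... | yes refl = xj≡yj
  ... | no i≢j   = agree i [ i∉F , i≢j ]

  _[_≔_] : V → Fin t → V → V
  (v [ j ≔ w ]) i with i ≟ j
  ... | yes _ = w i
  ... | no _  = v i

  ≔-same : ∀ (v w : V) j → (v [ j ≔ w ]) j ≡ w j
  ≔-same v w j with j ≟ j
  ... | yes _   = refl
  ... | no j≢j  = ⊥-elim (j≢j refl)

  ≔-other : ∀ (v w : V) {i j} → i ≢ j → (v [ j ≔ w ]) i ≡ v i
  ≔-other v w {i} {j} i≢j with i ≟ j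
  ... | yes i≡j = ⊥-elim (i≢j i≡j)
  ... | no _    = refl

  ≔-agree : ∀ (v w : V) j → AgreeOutside (_≡ j) (v [ j ≔ w ]) v
  ≔-agree v w j i i≢j = ≔-other v w i≢j

  agree-≔ : ∀ {F : Fin t → Set} {v w u : V} {j} → AgreeOutside (F ⊕ j) v u → (¬ F j → w j ≡ u j) →
            AgreeOutside F (v [ j ≔ w ]) u
  agree-≔ {j = j} agree fits i i∉F with i ≟ j
  ... | yes refl = fits i∉F
  ... | no i≢j   = agree i [ i∉F , i≢j ]

  ≔-adjacent : ∀ (v w : V) j → v j ≢ w j → Adjacent v (v [ j ≔ w ])
  ≔-adjacent v w j differ = j , (λ e → differ (trans e (≔-same v w j))) , λ i i≢j → sym (≔-other v w i≢j)

  adjacent-sym : ∀ {u v : V} → Adjacent u v → Adjacent v u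
  adjacent-sym (i , differ , agree) = i , differ ∘ sym , λ j j≢i → sym (agree j j≢i)

  corner : ∀ {u s : V} {a c} → a ≢ c → u a ≢ s a → u c ≢ s c → AgreeOutside (λ i → i ≡ a ⊎ i ≡ c) s u →
           Adjacent u (u [ a ≔ s ]) × Adjacent s (u [ a ≔ s ])
  corner {u} {s} {a} {c} a≢c ua≢sa uc≢sc s≈u =
    ≔-adjacent u s a ua≢sa , c , (λ e → uc≢sc (sym (trans e (≔-other u s (a≢c ∘ sym))))) , s≈corner
    where
    s≈corner : ∀ i → i ≢ c → s i ≡ (u [ a ≔ s ]) i
    s≈corner i i≢c with i ≟ a
    ... | yes refl = refl
    ... | no i≢a   = s≈u i [ i≢a , i≢c ]

  adjacent-resp : ∀ {u v v′ : V} → SameVertex v v′ → Adjacent u v → Adjacent u v′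
  adjacent-resp v≈v′ (i , differ , agree) =
    i , (λ e → differ (trans e (sym (v≈v′ i)))) , λ j j≢i → trans (agree j j≢i) (v≈v′ j)

  Active-mono : ∀ {S : List V} {k l} {v : V} → k ≤ l → Active S k v → Active S l v
  Active-mono = go ∘ ≤⇒≤′
    where
    go : ∀ {S : List V} {k l} {v : V} → k ≤′ l → Active S k v → Active S l v
    go (≤′-reflexive refl) a = a
    go (≤′-step k≤l)       a = inj₁ (go k≤l a)

module Boxes (t : ℕ) (n : Fin t → ℕ) where
  open Hamming t n

  record Box : Set where
    constructor box
    field
      free : Subset t
      base : V
  open Box

  _∈B_ : V → Box → Set
  x ∈B B = AgreeOutside (_∈ free B) x (base B)

  cost : Box → ℕ
  cost B = 2 + ∣ free B ∣

  totalCost : List Box → ℕ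
  totalCost C = sum (map cost C)

  Conflict : Box → Box → Fin t → Set
  Conflict B₁ B₂ i = i ∉ free B₁ × i ∉ free B₂ × base B₁ i ≢ base B₂ i

  Near : Box → Box → Set
  Near B₁ B₂ = Σ (Subset t) λ D → ∣ D ∣ ≤ 2 × (∀ i → Conflict B₁ B₂ i → i ∈ D)

  near? : ∀ B₁ B₂ → Dec (Near B₁ B₂)
  near? B₁ B₂ = anySubset? λ D → (∣ D ∣ ≤? 2) ×-dec all? λ i → conflict? i →-dec (i ∈? D)
    where
    conflict? : ∀ i → Dec (Conflict B₁ B₂ i)
    conflict? i = ¬? (i ∈? free B₁) ×-dec (¬? (i ∈? free B₂) ×-dec ¬? (base B₁ i ≟ base B₂ i))

  Near-sym : ∀ {B₁ B₂} → Near B₁ B₂ → Near B₂ B₁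
  Near-sym (D , small , covers) = D , small , λ i (i∉₂ , i∉₁ , differ) → covers i (i∉₁ , i∉₂ , differ ∘ sym)

  near-if-agree : ∀ {B₁ B₂ u w a c} → u ∈B B₁ → w ∈B B₂ →
                  AgreeOutside (λ i → i ≡ a ⊎ i ≡ c) u w → Near B₁ B₂
  near-if-agree {B₁} {B₂} {u} {w} {a} {c} u∈ w∈ agree = ⁅ a ⁆ ∪ ⁅ c ⁆ , small , covers
    where
    small : ∣ ⁅ a ⁆ ∪ ⁅ c ⁆ ∣ ≤ 2
    small = ≤-trans (∣p∪q∣≤∣p∣+∣q∣ ⁅ a ⁆ ⁅ c ⁆) (≤-reflexive (cong₂ _+_ (∣⁅x⁆∣≡1 a) (∣⁅x⁆∣≡1 c)))
    covers : ∀ i → Conflict B₁ B₂ i → i ∈ ⁅ a ⁆ ∪ ⁅ c ⁆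
    covers i (i∉₁ , i∉₂ , differ) with (i ≟ a) ⊎-dec (i ≟ c)
    ... | yes (inj₁ refl) = p⊆p∪q ⁅ c ⁆ (x∈⁅x⁆ i)
    ... | yes (inj₂ refl) = q⊆p∪q ⁅ a ⁆ ⁅ c ⁆ (x∈⁅x⁆ i)
    ... | no i∉ac = ⊥-elim (differ (trans (sym (u∈ i i∉₁)) (trans (agree i i∉ac) (w∈ i i∉₂))))

  agree-via-neighbour : ∀ {u v w : V} (uv : Adjacent u v) (wv : Adjacent w v) →
                        AgreeOutside (λ i → i ≡ proj₁ uv ⊎ i ≡ proj₁ wv) u w
  agree-via-neighbour (a , _ , uv) (c , _ , wv) i i∉ac =
    trans (uv i (i∉ac ∘ inj₁)) (sym (wv i (i∉ac ∘ inj₂)))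

  box-closed : ∀ {u v w : V} (B : Box) → u ∈B B → w ∈B B → Distinct u w →
               Adjacent u v → Adjacent w v → v ∈B B
  box-closed {u} {v} {w} B u∈ w∈ u≢w (a , _ , uv) (c , _ , wv) i i∉ with i ≟ a | i ≟ c
  ... | no i≢a   | _        = trans (sym (uv i i≢a)) (u∈ i i∉)
  ... | yes _    | no i≢c   = trans (sym (wv i i≢c)) (w∈ i i∉)
  ... | yes refl | yes refl = ⊥-elim (u≢w u≈w)
    where
    u≈w : SameVertex u w
    u≈w j with j ≟ i
    ... | yes refl = trans (u∈ j i∉) (sym (w∈ j i∉))
    ... | no j≢i   = trans (uv j j≢i) (sym (wv j j≢i))

  merge : Box → Box → Subset t → Box
  merge B₁ B₂ D = box (free B₁ ∪ (free B₂ ∪ D)) (base B₁)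

  ∉-merge : ∀ B₁ B₂ D {i} → i ∉ free (merge B₁ B₂ D) → i ∉ free B₁ × i ∉ free B₂ × i ∉ D
  ∉-merge B₁ B₂ D i∉ =
    i∉ ∘ p⊆p∪q _ , i∉ ∘ q⊆p∪q (free B₁) _ ∘ p⊆p∪q D , i∉ ∘ q⊆p∪q (free B₁) _ ∘ q⊆p∪q (free B₂) D

  ∈-merge₁ : ∀ {x} B₁ B₂ D → x ∈B B₁ → x ∈B merge B₁ B₂ D
  ∈-merge₁ B₁ B₂ D x∈ i i∉ = x∈ i (proj₁ (∉-merge B₁ B₂ D i∉))

  ∈-merge₂ : ∀ {x} B₁ B₂ D → (∀ i → Conflict B₁ B₂ i → i ∈ D) → x ∈B B₂ → x ∈B merge B₁ B₂ D
  ∈-merge₂ B₁ B₂ D covers x∈ i i∉ with ∉-merge B₁ B₂ D i∉ | base B₁ i ≟ base B₂ i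
  ... | _ , i∉₂ , _     | yes same  = trans (x∈ i i∉₂) (sym same)
  ... | i∉₁ , i∉₂ , i∉D | no differ = ⊥-elim (i∉D (covers i (i∉₁ , i∉₂ , differ)))

  cost-merge : ∀ B₁ B₂ D → ∣ D ∣ ≤ 2 → cost (merge B₁ B₂ D) ≤ cost B₁ + cost B₂
  cost-merge B₁ B₂ D small = s≤s (s≤s (begin
    ∣ free B₁ ∪ (free B₂ ∪ D) ∣         ≤⟨ ∣p∪q∣≤∣p∣+∣q∣ (free B₁) _ ⟩
    ∣ free B₁ ∣ + ∣ free B₂ ∪ D ∣        ≤⟨ +-monoʳ-≤ ∣ free B₁ ∣ (∣p∪q∣≤∣p∣+∣q∣ (free B₂) D) ⟩
    ∣ free B₁ ∣ + (∣ free B₂ ∣ + ∣ D ∣) ≤⟨ +-monoʳ-≤ ∣ free B₁ ∣ (+-monoʳ-≤ ∣ free B₂ ∣ small) ⟩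
    ∣ free B₁ ∣ + (∣ free B₂ ∣ + 2)     ≡⟨ cong (∣ free B₁ ∣ +_) (+-comm ∣ free B₂ ∣ 2) ⟩
    ∣ free B₁ ∣ + cost B₂               ∎))
    where open ≤-Reasoning

  Normal : List Box → Set
  Normal = AllPairs (λ B₁ B₂ → ¬ Near B₁ B₂)

  normal-near : ∀ {C B₁ B₂} → Normal C → B₁ ∈ˡ C → B₂ ∈ˡ C → Near B₁ B₂ → B₁ ≡ B₂
  normal-near (_ ∷ _)    (here refl) (here refl) _    = refl
  normal-near (far ∷ _)  (here refl) (there B₂∈) near = ⊥-elim (All.lookup far B₂∈ near)
  normal-near (far ∷ _)  (there B₁∈) (here refl) near = ⊥-elim (All.lookup far B₁∈ (Near-sym near))
  normal-near (_ ∷ norm) (there B₁∈) (there B₂∈) near = normal-near norm B₁∈ B₂∈ near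

  Covered : List Box → V → Set
  Covered C x = Σ Box λ B → B ∈ˡ C × x ∈B B

  covers-active : ∀ {S C} → Normal C → (∀ x → x ∈S S → Covered C x) → ∀ k v → Active S k v → Covered C v
  covers-active norm seeds zero v v∈S = seeds v v∈S
  covers-active norm seeds (suc k) v (inj₁ active) = covers-active norm seeds k v active
  covers-active norm seeds (suc k) v (inj₂ (u , w , u≢w , uv , wv , active-u , active-w))
    with covers-active norm seeds k u active-u | covers-active norm seeds k w active-w
  ... | B , B∈ , u∈ | B′ , B′∈ , w∈ with normal-near norm B∈ B′∈ (near-if-agree u∈ w∈ (agree-via-neighbour uv wv))
  ... | refl = B , B∈ , box-closed B u∈ w∈ u≢w uv wv

  cost≤totalCost : ∀ {B C} → B ∈ˡ C → cost B ≤ totalCost C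
  cost≤totalCost {C = B ∷ C} (here refl) = m≤m+n (cost B) (totalCost C)
  cost≤totalCost {C = B′ ∷ C} (there B∈) = ≤-trans (cost≤totalCost B∈) (m≤n+m (totalCost C) (cost B′))

  record Absorption (B : Box) (C : List Box) : Set where
    field
      boxes  : List Box
      normal : Normal boxes
      cheap  : totalCost boxes ≤ cost B + totalCost C
      covers : ∀ x → x ∈B B ⊎ Covered C x → Covered boxes x

  module MergeStep {B : Box} {C : List Box} (near-B′ : Any (Near B) C) where
    B′ : Box
    B′ = Any.lookup near-B′
    D : Subset t
    D = proj₁ (lookup-result near-B′)
    small : ∣ D ∣ ≤ 2
    small = proj₁ (proj₂ (lookup-result near-B′))
    conflicts⊆D : ∀ i → Conflict B B′ i → i ∈ D
    conflicts⊆D = proj₂ (proj₂ (lookup-result near-B′))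
    rest : List Box
    rest = C ─ near-B′
    merged : Box
    merged = merge B B′ D

    lift : Absorption merged rest → Absorption B C
    lift absorption = record
      { boxes  = boxes
      ; normal = normal
      ; cheap  = ≤-trans cheap (begin
          cost merged + totalCost rest        ≤⟨ +-mono-≤ (cost-merge B B′ D small) ≤-refl ⟩
          cost B + cost B′ + totalCost rest   ≡⟨ +-assoc (cost B) (cost B′) _ ⟩
          cost B + (cost B′ + totalCost rest) ≡⟨ cong (cost B +_) (sym (sum-─ cost near-B′)) ⟩
          cost B + totalCost C                ∎)
      ; covers = covers′
      }
      where
      open ≤-Reasoning
      open Absorption absorption
      covers′ : ∀ x → x ∈B B ⊎ Covered C x → Covered boxes x
      covers′ x (inj₁ x∈) = covers x (inj₁ (∈-merge₁ B B′ D x∈))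
      covers′ x (inj₂ (B″ , B″∈ , x∈)) with ∈-─ near-B′ B″∈
      ... | inj₁ refl  = covers x (inj₁ (∈-merge₂ B B′ D conflicts⊆D x∈))
      ... | inj₂ B″∈′ = covers x (inj₂ (B″ , B″∈′ , x∈))

  -- insert B into a normal collection, merging with a near box as long as there is one;
  -- every merge shortens the collection, so the fuel bounds the number of merges
  insert : ∀ fuel (B : Box) (C : List Box) → length C < fuel → Normal C → Absorption B C
  insert (suc fuel) B C len norm with Any.any? (near? B) C
  ... | no far = record
    { boxes  = B ∷ C
    ; normal = ¬Any⇒All¬ C far ∷ norm
    ; cheap  = ≤-refl
    ; covers = λ x → [ (λ x∈ → B , here refl , x∈) , (λ (B′ , B′∈ , x∈) → B′ , there B′∈ , x∈) ]
    }
  ... | yes near-B′ = lift (insert fuel merged rest shorter (AllPairs-─ near-B′ norm))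
    where
    open MergeStep near-B′
    shorter : length rest < fuel
    shorter = ≤-pred (≤-trans (s≤s (≤-reflexive (sym (length-removeAt′ C (Any.index near-B′))))) len)

  cover-seeds : ∀ (S : List V) →
    Σ (List Box) λ C → Normal C × totalCost C ≤ length S + length S × (∀ x → x ∈S S → Covered C x)
  cover-seeds [] = [] , [] , z≤n , λ _ ()
  cover-seeds (s ∷ S) with cover-seeds S
  ... | C , norm , C-cheap , C-covers = boxes , normal , cheap′ , seeds′
    where
    point : Box
    point = box ⊥ s
    open Absorption (insert (suc (length C)) point C ≤-refl norm)
    cheap′ : totalCost boxes ≤ suc (length S) + suc (length S)
    cheap′ = begin
      totalCost boxes                    ≤⟨ cheap ⟩
      2 + ∣ ⊥ {n = t} ∣ + totalCost C    ≡⟨ cong (λ k → 2 + k + totalCost C) (∣⊥∣≡0 t) ⟩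
      2 + totalCost C                    ≤⟨ s≤s (s≤s C-cheap) ⟩
      2 + (length S + length S)          ≡⟨ cong suc (sym (+-suc (length S) (length S))) ⟩
      suc (length S) + suc (length S)    ∎
      where open ≤-Reasoning
    seeds′ : ∀ x → x ∈S (s ∷ S) → Covered boxes x
    seeds′ x (here x≈s)  = covers x (inj₁ λ i _ → x≈s i)
    seeds′ x (there x∈S) = covers x (inj₂ (C-covers x x∈S))

  lower-bound : ∀ (z o : V) → (∀ i → z i ≢ o i) → ∀ S → Percolates S → 2 + t ≤ length S + length S
  lower-bound z o z≢o S (k , all-active) with cover-seeds S
  ... | C , norm , cheap , seeds = begin
      2 + t                    ≡⟨ cong (2 +_) (sym (∣⊤∣≡n t)) ⟩
      2 + ∣ ⊤ {n = t} ∣        ≤⟨ s≤s (s≤s (p⊆q⇒∣p∣≤∣q∣ {p = ⊤} {q = free B} λ {i} _ → all-free i)) ⟩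
      cost B                   ≤⟨ cost≤totalCost B∈ ⟩
      totalCost C              ≤⟨ cheap ⟩
      length S + length S      ∎
    where
    open ≤-Reasoning
    covered : ∀ v → Covered C v
    covered v = covers-active norm seeds k v (all-active v)
    B : Box
    B = proj₁ (covered z)
    B∈ : B ∈ˡ C
    B∈ = proj₁ (proj₂ (covered z))
    z∈ : z ∈B B
    z∈ = proj₂ (proj₂ (covered z))
    -- the neighbour of z in direction i lies in the same box, so i cannot be fixed
    all-free : ∀ i → i ∈ free B
    all-free i with i ∈? free B | covered (z [ i ≔ o ])
    ... | yes i∈ | _ = i∈
    ... | no i∉ | B′ , B′∈ , x∈
      with normal-near norm B∈ B′∈ (near-if-agree {c = i} z∈ x∈ λ j j≢i → sym (≔-other z o (j≢i ∘ inj₁)))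
    ... | refl = ⊥-elim (z≢o i (trans (z∈ i i∉) (trans (sym (x∈ i i∉)) (≔-same z o i))))

module Spanning (t : ℕ) (n : Fin t → ℕ) (S : List (Vertex t n)) where
  open Hamming t n

  Spanned : (V → Set) → Set
  Spanned X = Σ ℕ λ k → ∀ x → X x → Active S k x

  Supported : (V → Set) → V → Set
  Supported X y = Σ V λ u → Σ V λ w → Distinct u w × Adjacent u y × Adjacent w y × X u × X w

  spanned-⊆ : ∀ {X Y : V → Set} → (∀ x → X x → Y x) → Spanned Y → Spanned X
  spanned-⊆ X⊆Y (k , active) = k , λ x x∈ → active x (X⊆Y x x∈)

  spanned-∪ : ∀ {X Y : V → Set} → Spanned X → Spanned Y → Spanned (λ x → X x ⊎ Y x)
  spanned-∪ (k , active-X) (l , active-Y) =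
    k ⊔ l , λ x → [ Active-mono (m≤m⊔n k l) ∘ active-X x , Active-mono (m≤n⊔m k l) ∘ active-Y x ]

  spanned-step : ∀ {X Y : V → Set} → Spanned X → (∀ y → Y y → X y ⊎ Supported X y) → Spanned Y
  spanned-step (k , active) step = suc k , λ y y∈ → [ inj₁ ∘ active y , activate ] (step y y∈)
    where
    activate : ∀ {y} → Supported _ y → Active S (suc k) y
    activate (u , w , u≢w , uy , wy , u∈ , w∈) = inj₂ (u , w , u≢w , uy , wy , active u u∈ , active w w∈)

  spanned-seed : ∀ {s} → s ∈S S → Spanned (SameVertex s)
  spanned-seed s∈S = zero , λ x s≈x → Any.map (λ s≈y i → trans (sym (s≈x i)) (s≈y i)) s∈S

  spanned-neighbour : ∀ {X : V → Set} {u v w} → Spanned X → X u → X w → Distinct u w →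
                      Adjacent u v → Adjacent w v → Spanned (SameVertex v)
  spanned-neighbour sp u∈ w∈ u≢w uv wv =
    spanned-step sp λ y v≈y → inj₂ (_ , _ , u≢w , adjacent-resp v≈y uv , adjacent-resp v≈y wv , u∈ , w∈)

  Cube : (Fin t → Set) → V → V → Set
  Cube F b x = AgreeOutside F x b

  -- Growing a spanned cube (F, b) by one coordinate j, given a spanned vertex p that
  -- differs from b exactly at j: first the translate of the cube through p is filled
  -- coordinate by coordinate, then every line in direction j meets both cubes.
  module Growth {F : Fin t → Set} {b p : V} (j : Fin t) (pj≢bj : p j ≢ b j) (p≈b : AgreeOutside (_≡ j) p b)
                (cube : Spanned (Cube F b)) (spanned-p : Spanned (SameVertex p)) where

    Translate : List (Fin t) → V → Set
    Translate L y = y j ≡ p j × Cube (F ⊕ j) b y × AgreeOutside (_∈ˡ L) y p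

    -- a vertex of the translate differing from p at i is supported by its neighbour
    -- in direction i (one step closer to p) and its neighbour in direction j (in the cube)
    translate-step : ∀ i L y → Translate (i ∷ L) y →
                     (Cube F b y ⊎ Translate L y) ⊎ Supported (λ x → Cube F b x ⊎ Translate L x) y
    translate-step i L y (yj , y∈ , y≈p) with y i ≟ p i
    ... | yes yi = inj₁ (inj₂ (yj , y∈ , agree-fill (agree-widen (λ k → swap ∘ Any.toSum) y≈p) yi))
    ... | no yi≢pi = inj₂ (y [ i ≔ p ] , y [ j ≔ b ] , differ-at-j ,
                           adjacent-sym (≔-adjacent y p i yi≢pi) ,
                           adjacent-sym (≔-adjacent y b j λ e → pj≢bj (trans (sym yj) e)) ,
                           inj₂ (trans (≔-other y p j≢i) yj , on-cube , on-L) ,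
                           inj₁ (agree-≔ y∈ λ _ → refl))
      where
      j≢i : j ≢ i
      j≢i refl = yi≢pi yj
      differ-at-j : Distinct (y [ i ≔ p ]) (y [ j ≔ b ])
      differ-at-j same = pj≢bj (trans (sym yj) (trans (sym (≔-other y p j≢i)) (trans (same j) (≔-same y b j))))
      on-cube : Cube (F ⊕ j) b (y [ i ≔ p ])
      on-cube = agree-≔ (agree-widen (λ k → inj₁) y∈) λ _ → p≈b i (j≢i ∘ sym)
      on-L : AgreeOutside (_∈ˡ L) (y [ i ≔ p ]) p
      on-L = agree-≔ (agree-widen (λ k → swap ∘ Any.toSum) y≈p) λ _ → refl

    translate : ∀ L → Spanned (Translate L)
    translate []      = spanned-⊆ (λ y (_ , _ , y≈p) i → sym (y≈p i λ ())) spanned-p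
    translate (i ∷ L) = spanned-step (spanned-∪ cube (translate L)) (translate-step i L)

    fill-line : ∀ x → Cube (F ⊕ j) b x →
                (Cube F b x ⊎ Translate (allFin t) x) ⊎ Supported (λ y → Cube F b y ⊎ Translate (allFin t) y) x
    fill-line x x∈ with x j ≟ b j | x j ≟ p j
    ... | yes xj≡bj | _         = inj₁ (inj₁ (agree-fill x∈ xj≡bj))
    ... | no _      | yes xj≡pj = inj₁ (inj₂ (xj≡pj , x∈ , λ k k∉ → ⊥-elim (k∉ (∈-allFin k))))
    ... | no xj≢bj  | no xj≢pj  =
      inj₂ (x [ j ≔ b ] , x [ j ≔ p ] , differ-at-j ,
            adjacent-sym (≔-adjacent x b j xj≢bj) , adjacent-sym (≔-adjacent x p j xj≢pj) ,
            inj₁ (agree-≔ x∈ λ _ → refl) ,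
            inj₂ (≔-same x p j , agree-≔ (agree-widen (λ _ → inj₁) x∈) (λ j∉ → ⊥-elim (j∉ (inj₂ refl))) ,
                  λ k k∉ → ⊥-elim (k∉ (∈-allFin k))))
      where
      differ-at-j : Distinct (x [ j ≔ b ]) (x [ j ≔ p ])
      differ-at-j same = pj≢bj (trans (sym (≔-same x p j)) (trans (sym (same j)) (≔-same x b j)))

    grown : Spanned (Cube (F ⊕ j) b)
    grown = spanned-step (spanned-∪ cube (translate (allFin t))) fill-line

  grow : ∀ {F : Fin t → Set} {b p : V} j → p j ≢ b j → AgreeOutside (_≡ j) p b →
         Spanned (Cube F b) → Spanned (SameVertex p) → Spanned (Cube (F ⊕ j) b)
  grow = Growth.grown

data Block (t : ℕ) : Set where
  single : Fin t → Block t
  pair   : (a c : Fin t) → a ≢ c → Block t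

_∈ᵇ_ : ∀ {t} → Fin t → Block t → Set
i ∈ᵇ single a   = i ≡ a
i ∈ᵇ pair a c _ = i ≡ a ⊎ i ≡ c

_∈ᵇ?_ : ∀ {t} (i : Fin t) (β : Block t) → Dec (i ∈ᵇ β)
i ∈ᵇ? single a   = i ≟ a
i ∈ᵇ? pair a c _ = (i ≟ a) ⊎-dec (i ≟ c)

lead : ∀ {t} → Block t → Fin t
lead (single a)   = a
lead (pair a _ _) = a

lead∈ : ∀ {t} (β : Block t) → lead β ∈ᵇ β
lead∈ (single a)   = refl
lead∈ (pair a _ _) = inj₁ refl

Disjoint : ∀ {t} → Block t → Block t → Set
Disjoint β γ = ∀ i → i ∈ᵇ β → i ∈ᵇ γ → Empty

shift : ∀ {t} → Block t → Block (suc (suc t))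
shift (single a)     = single (Fin.suc (Fin.suc a))
shift (pair a c a≢c) = pair (Fin.suc (Fin.suc a)) (Fin.suc (Fin.suc c)) (a≢c ∘ fin-suc-injective ∘ fin-suc-injective)

shift⁺ : ∀ {t} {i : Fin t} (β : Block t) → i ∈ᵇ β → Fin.suc (Fin.suc i) ∈ᵇ shift β
shift⁺ (single a)   refl = refl
shift⁺ (pair a c _) i∈   = ⊎-map (cong (Fin.suc ∘ Fin.suc)) (cong (Fin.suc ∘ Fin.suc)) i∈

shift⁻ : ∀ {t} {i : Fin (suc (suc t))} (β : Block t) → i ∈ᵇ shift β →
         ∃ λ j → i ≡ Fin.suc (Fin.suc j) × j ∈ᵇ β
shift⁻ (single a)   refl        = a , refl , refl
shift⁻ (pair a c _) (inj₁ refl) = a , refl , inj₁ refl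
shift⁻ (pair a c _) (inj₂ refl) = c , refl , inj₂ refl

pairing : ∀ t → List (Block t)
pairing zero          = []
pairing (suc zero)    = single Fin.zero ∷ []
pairing (suc (suc t)) = pair Fin.zero (Fin.suc Fin.zero) (λ ()) ∷ map shift (pairing t)

length-pairing : ∀ t → length (pairing t) ≡ ⌈ t /2⌉
length-pairing zero          = refl
length-pairing (suc zero)    = refl
length-pairing (suc (suc t)) = cong suc (trans (length-map shift (pairing t)) (length-pairing t))

pairing-covers : ∀ t (i : Fin t) → Any (i ∈ᵇ_) (pairing t)
pairing-covers (suc zero)    Fin.zero              = here refl
pairing-covers (suc (suc t)) Fin.zero              = here (inj₁ refl)
pairing-covers (suc (suc t)) (Fin.suc Fin.zero)    = here (inj₂ refl)
pairing-covers (suc (suc t)) (Fin.suc (Fin.suc i)) =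
  there (Any-map⁺ (Any.map (λ {β} → shift⁺ β) (pairing-covers t i)))

pairing-disjoint : ∀ t → AllPairs Disjoint (pairing t)
pairing-disjoint zero          = []
pairing-disjoint (suc zero)    = [] ∷ []
pairing-disjoint (suc (suc t)) =
  All-map⁺ (All.universal first-disjoint (pairing t)) ∷ AllPairs-map⁺ (AllPairs.map shift-disjoint (pairing-disjoint t))
  where
  first-disjoint : ∀ γ → Disjoint (pair Fin.zero (Fin.suc Fin.zero) (λ ())) (shift γ)
  first-disjoint γ i i∈ i∈γ with shift⁻ γ i∈γ
  first-disjoint γ i (inj₁ refl) _ | _ , () , _
  first-disjoint γ i (inj₂ refl) _ | _ , () , _
  shift-disjoint : ∀ {β γ} → Disjoint β γ → Disjoint (shift β) (shift γ)
  shift-disjoint {β} {γ} disjoint i i∈β i∈γ with shift⁻ β i∈β | shift⁻ γ i∈γ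
  ... | j , refl , j∈β | _ , refl , j∈γ = disjoint j j∈β j∈γ

module Construction (t : ℕ) (n : Fin t → ℕ) (z o : Vertex t n) (z≢o : ∀ i → z i ≢ o i) where
  open Hamming t n

  seed : Block t → V
  seed β i with i ∈ᵇ? β
  ... | yes _ = o i
  ... | no _  = z i

  seed-inside : ∀ β {i} → i ∈ᵇ β → seed β i ≡ o i
  seed-inside β {i} i∈ with i ∈ᵇ? β
  ... | yes _ = refl
  ... | no i∉ = ⊥-elim (i∉ i∈)

  seed-outside : ∀ β → AgreeOutside (_∈ᵇ β) (seed β) z
  seed-outside β i i∉ with i ∈ᵇ? β
  ... | yes i∈ = ⊥-elim (i∉ i∈)
  ... | no _   = refl

  z≢seed : ∀ β {i} → i ∈ᵇ β → z i ≢ seed β i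
  z≢seed β i∈ e = z≢o _ (trans e (seed-inside β i∈))

  -- seeds of disjoint blocks differ at the lead coordinate of the first one
  disjoint⇒distinct : ∀ {β γ} → Disjoint β γ → Distinct (seed β) (seed γ)
  disjoint⇒distinct {β} {γ} disjoint same =
    z≢seed β (lead∈ β) (trans (sym (seed-outside γ (lead β) (disjoint (lead β) (lead∈ β)))) (sym (same (lead β))))

  seeds : List V
  seeds = z ∷ map seed (pairing t)

  open Spanning t n seeds

  absorb : ∀ {F : Fin t → Set} β → seed β ∈S seeds → Spanned (Cube F z) → Spanned (Cube (λ i → F i ⊎ i ∈ᵇ β) z)
  absorb (single a) s∈ cube =
    grow a (z≢seed (single a) refl ∘ sym) (seed-outside (single a)) cube (spanned-seed s∈)
  absorb (pair a c a≢c) s∈ cube =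
    spanned-⊆ (λ _ → agree-widen (λ _ → assocˡ))
      (grow-towards (a≢c ∘ sym) (inj₂ refl) (inj₁ refl) (λ i i∉ → seed-outside β i (i∉ ∘ swap))
        (grow-towards a≢c (inj₁ refl) (inj₂ refl) (seed-outside β) cube))
    where
    β : Block t
    β = pair a c a≢c
    s : V
    s = seed β
    -- the common neighbour z [ a′ ≔ s ] of z and s becomes active and lets the cube grow by a′
    grow-towards : ∀ {G : Fin t → Set} {a′ c′} → a′ ≢ c′ → a′ ∈ᵇ β → c′ ∈ᵇ β →
                   AgreeOutside (λ i → i ≡ a′ ⊎ i ≡ c′) s z → Spanned (Cube G z) → Spanned (Cube (G ⊕ a′) z)
    grow-towards {a′ = a′} a′≢c′ a′∈ c′∈ s≈z cube′ =
      grow a′ (λ e → z≢seed β a′∈ (sym (trans (sym (≔-same z s a′)) e))) (≔-agree z s a′) cube′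
        (spanned-neighbour (spanned-∪ cube′ (spanned-seed s∈)) (inj₁ λ _ _ → refl) (inj₂ λ _ → refl)
          (λ same → z≢seed β a′∈ (same a′)) (proj₁ neighbours) (proj₂ neighbours))
      where
      neighbours : Adjacent z (z [ a′ ≔ s ]) × Adjacent s (z [ a′ ≔ s ])
      neighbours = corner a′≢c′ (z≢seed β a′∈) (z≢seed β c′∈) s≈z

  absorb-all : ∀ {F : Fin t → Set} βs → All (λ β → seed β ∈S seeds) βs → Spanned (Cube F z) →
               Spanned (Cube (λ i → F i ⊎ Any (i ∈ᵇ_) βs) z)
  absorb-all [] [] cube = spanned-⊆ (λ _ → agree-widen (λ _ → [ id , (λ ()) ])) cube
  absorb-all (β ∷ βs) (s∈ ∷ s∈s) cube =
    spanned-⊆ (λ _ → agree-widen (λ _ → [ inj₁ ∘ inj₁ , [ inj₁ ∘ inj₂ , inj₂ ] ∘ Any.toSum ]))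
      (absorb-all βs s∈s (absorb β s∈ cube))

  seeds-in : All (λ β → seed β ∈S seeds) (pairing t)
  seeds-in = All.tabulate λ β∈ → there (Any-map⁺ (Any.map (λ { refl _ → refl }) β∈))

  seeds-distinct : IsSet seeds
  seeds-distinct =
    All-map⁺ (All.universal (λ β same → z≢seed β (lead∈ β) (same (lead β))) (pairing t)) ∷
    AllPairs-map⁺ (AllPairs.map disjoint⇒distinct (pairing-disjoint t))

  seeds-percolate : Percolates seeds
  seeds-percolate = proj₁ everything , λ v → proj₂ everything v λ i i∉ → ⊥-elim (i∉ (inj₂ (pairing-covers t i)))
    where
    start : Spanned (Cube (λ _ → Empty) z)
    start = spanned-⊆ (λ x x∈ i → sym (x∈ i λ ())) (spanned-seed (here λ _ → refl))
    everything : Spanned (Cube (λ i → Empty ⊎ Any (i ∈ᵇ_) (pairing t)) z)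
    everything = absorb-all (pairing t) seeds-in start

  upper-bound : Σ (List V) λ S → IsSet S × length S ≡ 1 + ⌈ t /2⌉ × Percolates S
  upper-bound = seeds , seeds-distinct , cong suc (trans (length-map seed (pairing t)) (length-pairing t)) , seeds-percolate

⌈m+m/2⌉≡m : ∀ m → ⌈ m + m /2⌉ ≡ m
⌈m+m/2⌉≡m zero    = refl
⌈m+m/2⌉≡m (suc m) = cong suc (trans (cong ⌊_/2⌋ (+-suc m m)) (⌈m+m/2⌉≡m m))

half-bound : ∀ t L → 2 + t ≤ L + L → 1 + ⌈ t /2⌉ ≤ L
half-bound t L h = ≤-trans (⌈n/2⌉-mono h) (≤-reflexive (⌈m+m/2⌉≡m L))

module Opposite (t : ℕ) (n : Fin t → ℕ) (two≤n : ∀ i → 2 ≤ n i) where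

  first second : ∀ {m} → 2 ≤ m → Fin m
  first (s≤s _) = Fin.zero
  second (s≤s (s≤s _)) = Fin.suc Fin.zero

  first≢second : ∀ {m} (two≤m : 2 ≤ m) → first two≤m ≢ second two≤m
  first≢second (s≤s (s≤s _)) ()

  z o : Vertex t n
  z i = first (two≤n i)
  o i = second (two≤n i)

  z≢o : ∀ i → z i ≢ o i
  z≢o i = first≢second (two≤n i)

theorem18 : (t : ℕ) → (n : Fin t → ℕ) → 1 ≤ t → (∀ i → 2 ≤ n i) →
    MinSeed2≡ {t} {n} (1 + ⌈ t /2⌉)
theorem18 t n _ two≤n = upper-bound , λ S _ percolates → half-bound t (length S) (lower-bound z o z≢o S percolates)
  where
  open Opposite t n two≤n
  open Boxes t n using (lower-bound)
  open Construction t n z o z≢o using (upper-bound)
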